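{- For every positive rational number $q$, $$\sum_{d \in \mathbb{N}:\ \varphi(d)/d = q} \frac{1}{d} \leq 1,$$ where $\varphi$ is the Euler totient function. -}

module Defs where

open import Data.Nat using (ℕ; zero; suc)
open import Data.Nat.GCD using (gcd)
open import Data.List using (List; length; filter; map; sum)
open import Data.List using (upTo)
open import Data.Integer using (+_)
open import Data.Rational using (ℚ; _/_; _+_; 0ℚ) renaming (_≟_ to _≟ℚ_)
open import Relation.Nullary using (does)
open import Data.Bool using (if_then_else_)
open import Relation.Binary.PropositionalEquality using (_≡_)
open import Data.Nat using (NonZero) renaming (_≟_ to _≟ℕ_)

totient : ℕ → ℕ
totient n = length (filter (λ k → gcd (suc k) n ≟ℕ 1) (upTo n))

totientRatio : (d : ℕ) → .{{_ : NonZero d}} → ℚ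
totientRatio d = (+ totient d) / d

term : ℚ → (d : ℕ) → .{{_ : NonZero d}} → ℚ
term q d = if does (totientRatio d ≟ℚ q) then (+ 1) / d else 0ℚ

partialSum : ℚ → ℕ → ℚ
partialSum q zero = 0ℚ
partialSum q (suc m) = partialSum q m + term q (suc m)

module Submission where

-- Call a set C of positive integers on which φ(d)/d is constant a class. We show
-- Σ_{d ∈ C, d ≤ N} 1/d ≤ 1 by induction on N, simultaneously for all classes.
-- If d₀ > 1 lies in C and p is the largest prime factor of d₀, then p divides every
-- d ∈ C: otherwise a comparison of p-adic valuations (or of s-adic ones, s the largest
-- prime factor of d) rules out φ(d)/d = φ(d₀)/d₀. Writing d = e p, the set of such e
-- splits into {e : p ∣ e} and {e : p ∤ e}, on each of which φ(e)/e is again constant,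
-- because φ(e p) is p φ(e), resp. (p - 1) φ(e). Since 1/(e p) ≤ (1/2)(1/e), the sum over
-- C is at most half the sum of those over two classes, hence at most 1.

open import Algebra.Bundles using (CommutativeMonoid)
open import Data.Nat.Base using (ℕ; zero; suc; NonZero)
open import Defs
open import Level using (0ℓ)
open import Relation.Unary using (Pred; Decidable)

module RangeSum {c ℓ} (M : CommutativeMonoid c ℓ) where

  open import Data.Nat.Base using (_+_; _*_; _<_; s<s)
  open import Data.Nat.Divisibility using (_∣_; ∣m+n∣m⇒∣n; n∣m*n; >⇒∤)
  open import Data.Nat.Properties using (+-identityʳ; +-suc; +-comm; ≤-refl; m<n⇒m<1+n)
  open import Relation.Binary.PropositionalEquality using (_≡_; cong)
  open import Relation.Nullary using (¬_)
  open CommutativeMonoid M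
  open import Algebra.Definitions.RawMonoid rawMonoid using (_×_)
  open import Algebra.Properties.CommutativeSemigroup commutativeSemigroup using (interchange)
  open import Relation.Binary.Reasoning.Setoid setoid

  -- ∑ n f = f 1 ∙ f 2 ∙ ⋯ ∙ f n ; the value f 0 is never used.
  ∑ : ℕ → (ℕ → Carrier) → Carrier
  ∑ zero    f = ε
  ∑ (suc n) f = ∑ n f ∙ f (suc n)

  ∑-cong : ∀ n {f g} → (∀ k → f (suc k) ≈ g (suc k)) → ∑ n f ≈ ∑ n g
  ∑-cong zero    f≈g = refl
  ∑-cong (suc n) f≈g = ∙-cong (∑-cong n f≈g) (f≈g n)

  ∑-vanishing : ∀ n {f} → (∀ k → k < n → f (suc k) ≈ ε) → ∑ n f ≈ ε
  ∑-vanishing zero    f≈ε = refl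
  ∑-vanishing (suc n) f≈ε = begin
    ∑ n _ ∙ _ ≈⟨ ∙-cong (∑-vanishing n (λ k k<n → f≈ε k (m<n⇒m<1+n k<n))) (f≈ε n ≤-refl) ⟩
    ε ∙ ε     ≈⟨ identityˡ ε ⟩
    ε         ∎

  ∑-+ : ∀ m n f → ∑ (m + n) f ≈ ∑ m f ∙ ∑ n (λ k → f (m + k))
  ∑-+ m zero    f rewrite +-identityʳ m = sym (identityʳ _)
  ∑-+ m (suc n) f rewrite +-suc m n = begin
    ∑ (m + n) f ∙ f (suc (m + n))                     ≈⟨ ∙-congʳ (∑-+ m n f) ⟩
    (∑ m f ∙ ∑ n (λ k → f (m + k))) ∙ f (suc (m + n)) ≈⟨ assoc _ _ _ ⟩
    ∑ m f ∙ (∑ n (λ k → f (m + k)) ∙ f (suc (m + n))) ∎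

  ∑-∙ : ∀ n f g → ∑ n (λ k → f k ∙ g k) ≈ ∑ n f ∙ ∑ n g
  ∑-∙ zero    f g = sym (identityˡ ε)
  ∑-∙ (suc n) f g = trans (∙-congʳ (∑-∙ n f g)) (interchange _ _ _ _)

  ∑-periodic : ∀ m {n} f → (∀ k → f (n + k) ≈ f k) → ∑ (m * n) f ≈ m × ∑ n f
  ∑-periodic zero    f f-per = refl
  ∑-periodic (suc m) {n} f f-per = begin
    ∑ (n + m * n) f                     ≈⟨ ∑-+ n (m * n) f ⟩
    ∑ n f ∙ ∑ (m * n) (λ k → f (n + k)) ≈⟨ ∙-congˡ (∑-cong (m * n) (λ k → f-per (suc k))) ⟩
    ∑ n f ∙ ∑ (m * n) f                 ≈⟨ ∙-congˡ (∑-periodic m f f-per) ⟩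
    ∑ n f ∙ m × ∑ n f                   ∎

  ∑-multiples : ∀ p .{{_ : NonZero p}} f → (∀ k → ¬ p ∣ k → f k ≈ ε) →
                ∀ m → ∑ (m * p) f ≈ ∑ m (λ j → f (j * p))
  ∑-multiples p@(suc p′) f f≈ε zero    = refl
  ∑-multiples p@(suc p′) f f≈ε (suc m) = begin
    ∑ (p + m * p) f                              ≡⟨ cong (λ n → ∑ n f) (+-comm p (m * p)) ⟩
    ∑ (m * p + p) f                              ≈⟨ ∑-+ (m * p) p f ⟩
    ∑ (m * p) f ∙ (∑ p′ block ∙ f (m * p + p))
      ≈⟨ ∙-cong (∑-multiples p f f≈ε m) (∙-congʳ (∑-vanishing p′ gap)) ⟩
    ∑ m (λ j → f (j * p)) ∙ (ε ∙ f (m * p + p))  ≈⟨ ∙-congˡ (identityˡ _) ⟩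
    ∑ m (λ j → f (j * p)) ∙ f (m * p + p)
      ≡⟨ cong (λ n → ∑ m (λ j → f (j * p)) ∙ f n) (+-comm (m * p) p) ⟩
    ∑ (suc m) (λ j → f (j * p))                  ∎
    where
    block : ℕ → Carrier
    block k = f (m * p + k)
    gap : ∀ k → k < p′ → block (suc k) ≈ ε
    gap k k<p′ = f≈ε _ (λ p∣ → >⇒∤ (s<s k<p′) (∣m+n∣m⇒∣n p∣ (n∣m*n m)))

module Totient where

  open import Data.Bool.Base using (true; false; if_then_else_)
  open import Data.List.Base using (length; filter; upTo; [_]; _++_)
  open import Data.List.Properties using (length-++; filter-++; upTo-∷ʳ)
  open import Data.Nat.Base
  open import Data.Nat.Coprimality using (Coprime; coprime?; coprime-divisor; coprime-+; gcd≡1⇒coprime; coprime⇒gcd≡1)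
    renaming (sym to coprime-sym)
  open import Data.Nat.Divisibility
  open import Data.Nat.GCD using (gcd)
  open import Data.Nat.Primality using (Prime; prime⇒irreducible; prime⇒nonTrivial; prime⇒nonZero)
  open import Data.Nat.Properties
  open import Data.Product using (_×_; _,_; proj₁; proj₂)
  open import Data.Sum using (inj₁; inj₂)
  open import Function using (_∘_; _⇔_; mk⇔; Equivalence)
  open import Relation.Nullary using (Dec; yes; no; does; ¬_; contradiction)
  open import Relation.Nullary.Decidable using (does-⇔; dec-false; _×-dec_)
  open import Relation.Binary.PropositionalEquality hiding ([_])
  open import Algebra.Definitions.RawMonoid +-0-rawMonoid using () renaming (_×_ to _×ₙ_)
  open RangeSum +-0-commutativeMonoid
  open ≡-Reasoning

  𝟙 : ∀ {a} {A : Set a} → Dec A → ℕ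
  𝟙 a? = if does a? then 1 else 0

  𝟙-⇔ : ∀ {a b} {A : Set a} {B : Set b} → A ⇔ B → (a? : Dec A) (b? : Dec B) → 𝟙 a? ≡ 𝟙 b?
  𝟙-⇔ A⇔B a? b? = cong (if_then 1 else 0) (does-⇔ A⇔B a? b?)

  𝟙-no : ∀ {a} {A : Set a} → ¬ A → (a? : Dec A) → 𝟙 a? ≡ 0
  𝟙-no ¬a a? = cong (if_then 1 else 0) (dec-false a? ¬a)

  ×ₙ≡* : ∀ m n → m ×ₙ n ≡ m * n
  ×ₙ≡* zero    n = refl
  ×ₙ≡* (suc m) n = cong (n +_) (×ₙ≡* m n)

  length-filter-singleton : ∀ {P : Pred ℕ 0ℓ} (P? : Decidable P) x → length (filter P? [ x ]) ≡ 𝟙 (P? x)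
  length-filter-singleton P? x with does (P? x)
  ... | true  = refl
  ... | false = refl

  length-filter-upTo : ∀ {P : Pred ℕ 0ℓ} (P? : Decidable P) n →
                       length (filter P? (upTo n)) ≡ ∑ n (λ k → 𝟙 (P? (k ∸ 1)))
  length-filter-upTo P? zero    = refl
  length-filter-upTo P? (suc n) = begin
    length (filter P? (upTo (suc n)))                      ≡⟨ cong (length ∘ filter P?) (upTo-∷ʳ n) ⟨
    length (filter P? (upTo n ++ [ n ]))                   ≡⟨ cong length (filter-++ P? (upTo n) [ n ]) ⟩
    length (filter P? (upTo n) ++ filter P? [ n ])         ≡⟨ length-++ (filter P? (upTo n)) ⟩
    length (filter P? (upTo n)) + length (filter P? [ n ])
      ≡⟨ cong₂ _+_ (length-filter-upTo P? n) (length-filter-singleton P? n) ⟩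
    ∑ (suc n) (λ k → 𝟙 (P? (k ∸ 1)))                       ∎

  totient≡∑ : ∀ n → totient n ≡ ∑ n (λ k → 𝟙 (coprime? k n))
  totient≡∑ n = trans (length-filter-upTo _ n)
    (∑-cong n (λ k → 𝟙-⇔ (mk⇔ gcd≡1⇒coprime coprime⇒gcd≡1) (gcd (suc k) n ≟ 1) (coprime? (suc k) n)))

  coprime-∣ʳ : ∀ {m n o} → Coprime m n → o ∣ n → Coprime m o
  coprime-∣ʳ m⊥n o∣n (i∣m , i∣o) = m⊥n (i∣m , ∣-trans i∣o o∣n)

  coprime-∣ˡ : ∀ {m n o} → Coprime m n → o ∣ m → Coprime o n
  coprime-∣ˡ m⊥n o∣m = coprime-sym (coprime-∣ʳ (coprime-sym m⊥n) o∣m)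

  coprime-*ʳ : ∀ {m n o} → Coprime m n → Coprime m o → Coprime m (n * o)
  coprime-*ʳ m⊥n m⊥o (i∣m , i∣no) = m⊥o (i∣m , coprime-divisor (coprime-∣ˡ m⊥n i∣m) i∣no)

  coprime-+⇔ : ∀ {m n} → Coprime (n + m) n ⇔ Coprime m n
  coprime-+⇔ {m} {n} = mk⇔ from coprime-+
    where
    from : Coprime (n + m) n → Coprime m n
    from c (i∣m , i∣n) = c (∣m∣n⇒∣m+n i∣n i∣m , i∣n)

  𝟙-coprime-periodic : ∀ n k → 𝟙 (coprime? (n + k) n) ≡ 𝟙 (coprime? k n)
  𝟙-coprime-periodic n k = 𝟙-⇔ coprime-+⇔ (coprime? (n + k) n) (coprime? k n)

  prime∤⇒coprime : ∀ {p n} → Prime p → ¬ p ∣ n → Coprime n p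
  prime∤⇒coprime pp p∤n (i∣n , i∣p) with prime⇒irreducible pp i∣p
  ... | inj₁ i≡1 = i≡1
  ... | inj₂ refl = contradiction i∣n p∤n

  totient-*-∣ : ∀ m n → m ∣ n → totient (m * n) ≡ m * totient n
  totient-*-∣ m n m∣n = begin
    totient (m * n)                          ≡⟨ totient≡∑ (m * n) ⟩
    ∑ (m * n) (λ k → 𝟙 (coprime? k (m * n))) ≡⟨ ∑-cong (m * n) (λ k → 𝟙-coprime-mn≡n (suc k)) ⟩
    ∑ (m * n) (λ k → 𝟙 (coprime? k n))       ≡⟨ ∑-periodic m _ (𝟙-coprime-periodic n) ⟩
    m ×ₙ ∑ n (λ k → 𝟙 (coprime? k n))        ≡⟨ ×ₙ≡* m _ ⟩
    m * ∑ n (λ k → 𝟙 (coprime? k n))         ≡⟨ cong (m *_) (totient≡∑ n) ⟨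
    m * totient n                            ∎
    where
    coprime-mn⇔n : ∀ {k} → Coprime k (m * n) ⇔ Coprime k n
    coprime-mn⇔n {k} = mk⇔ to from
      where
      to : Coprime k (m * n) → Coprime k n
      to c = coprime-∣ʳ c (n∣m*n m)
      from : Coprime k n → Coprime k (m * n)
      from c = coprime-*ʳ (coprime-∣ʳ c m∣n) c
    𝟙-coprime-mn≡n : ∀ k → 𝟙 (coprime? k (m * n)) ≡ 𝟙 (coprime? k n)
    𝟙-coprime-mn≡n k = 𝟙-⇔ coprime-mn⇔n (coprime? k (m * n)) (coprime? k n)

  𝟙-partition : ∀ {a b c} {A : Set a} {B : Set b} {C : Set c} (a? : Dec A) (b? : Dec B) (c? : Dec C) →
                C ⇔ (A × ¬ B) → 𝟙 a? ≡ 𝟙 c? + 𝟙 (a? ×-dec b?)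
  𝟙-partition a? b? c? C⇔A∖B with a? | b? | c?
  ... | yes a | yes b | yes c = contradiction b (proj₂ (Equivalence.to C⇔A∖B c))
  ... | yes a | yes b | no  _ = refl
  ... | yes a | no ¬b | yes _ = refl
  ... | yes a | no ¬b | no ¬c = contradiction (Equivalence.from C⇔A∖B (a , ¬b)) ¬c
  ... | no ¬a | _     | yes c = contradiction (proj₁ (Equivalence.to C⇔A∖B c)) ¬a
  ... | no ¬a | _     | no  _ = refl

  coprime-*-prime⇔ : ∀ {p n k} → Prime p → ¬ p ∣ n → Coprime k (p * n) ⇔ (Coprime k n × ¬ p ∣ k)
  coprime-*-prime⇔ {p} {n} {k} pp p∤n = mk⇔ to from
    where
    to : Coprime k (p * n) → Coprime k n × ¬ p ∣ k
    to c = coprime-∣ʳ c (n∣m*n p) , λ p∣k → nonTrivial⇒≢1 ⦃ prime⇒nonTrivial pp ⦄ (c (p∣k , m∣m*n n))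
    from : Coprime k n × ¬ p ∣ k → Coprime k (p * n)
    from (c , p∤k) = coprime-*ʳ (prime∤⇒coprime pp p∤k) c

  -- Among 1, …, p n, those coprime to n but not to p n are the multiples j p with j coprime to n.
  totient-*-prime+totient : ∀ {p} n → Prime p → ¬ p ∣ n → totient (p * n) + totient n ≡ p * totient n
  totient-*-prime+totient {p} n pp p∤n = begin
    totient (p * n) + totient n
      ≡⟨ cong₂ _+_ (totient≡∑ (p * n)) multiples ⟩
    ∑ (p * n) (λ k → 𝟙 (coprime? k (p * n))) + ∑ (p * n) multiple
      ≡⟨ ∑-∙ (p * n) _ _ ⟨
    ∑ (p * n) (λ k → 𝟙 (coprime? k (p * n)) + multiple k)
      ≡⟨ ∑-cong (p * n) (split ∘ suc) ⟨
    ∑ (p * n) (λ k → 𝟙 (coprime? k n))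
      ≡⟨ ∑-periodic p _ (𝟙-coprime-periodic n) ⟩
    p ×ₙ ∑ n (λ k → 𝟙 (coprime? k n))
      ≡⟨ ×ₙ≡* p _ ⟩
    p * ∑ n (λ k → 𝟙 (coprime? k n))
      ≡⟨ cong (p *_) (totient≡∑ n) ⟨
    p * totient n
      ∎
    where
    instance _ = prime⇒nonZero pp
    multiple : ℕ → ℕ
    multiple k = 𝟙 (coprime? k n ×-dec p ∣? k)
    split : ∀ k → 𝟙 (coprime? k n) ≡ 𝟙 (coprime? k (p * n)) + multiple k
    split k = 𝟙-partition (coprime? k n) (p ∣? k) (coprime? k (p * n)) (coprime-*-prime⇔ pp p∤n)
    multiple⇔ : ∀ {j} → Coprime j n ⇔ (Coprime (j * p) n × p ∣ j * p)
    multiple⇔ {j} = mk⇔ to from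
      where
      to : Coprime j n → Coprime (j * p) n × p ∣ j * p
      to c = coprime-sym (coprime-*ʳ (coprime-sym c) (prime∤⇒coprime pp p∤n)) , n∣m*n j
      from : Coprime (j * p) n × p ∣ j * p → Coprime j n
      from (c , _) = coprime-∣ˡ c (m∣m*n p)
    multiple[j*p] : ∀ j → 𝟙 (coprime? j n) ≡ multiple (j * p)
    multiple[j*p] j = 𝟙-⇔ multiple⇔ (coprime? j n) (coprime? (j * p) n ×-dec p ∣? (j * p))
    multiple-off : ∀ k → ¬ p ∣ k → multiple k ≡ 0
    multiple-off k p∤k = 𝟙-no (p∤k ∘ proj₂) (coprime? k n ×-dec p ∣? k)
    multiples : totient n ≡ ∑ (p * n) multiple
    multiples = begin
      totient n                           ≡⟨ totient≡∑ n ⟩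
      ∑ n (λ k → 𝟙 (coprime? k n))        ≡⟨ ∑-cong n (multiple[j*p] ∘ suc) ⟩
      ∑ n (λ j → multiple (j * p))        ≡⟨ ∑-multiples p multiple multiple-off n ⟨
      ∑ (n * p) multiple                  ≡⟨ cong (λ m → ∑ m multiple) (*-comm n p) ⟩
      ∑ (p * n) multiple                  ∎

  totient-*-prime : ∀ {p} n → Prime p → ¬ p ∣ n → totient (p * n) ≡ (p ∸ 1) * totient n
  totient-*-prime {p} n pp p∤n = begin
    totient (p * n)                         ≡⟨ m+n∸n≡m (totient (p * n)) (totient n) ⟨
    totient (p * n) + totient n ∸ totient n ≡⟨ cong (_∸ totient n) (totient-*-prime+totient n pp p∤n) ⟩
    p * totient n ∸ totient n               ≡⟨ cong (p * totient n ∸_) (*-identityˡ (totient n)) ⟨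
    p * totient n ∸ 1 * totient n           ≡⟨ *-distribʳ-∸ (totient n) p 1 ⟨
    (p ∸ 1) * totient n                     ∎

module SmoothNumbers where

  open import Data.List.Base using (_∷_; [])
  open import Data.List.Extrema.Nat using (max; argmax-all; v≤max⁺; xs≤max)
  open import Data.List.Membership.Propositional using (_∈_)
  open import Data.List.Relation.Unary.All as All using (_∷_)
  open import Data.List.Relation.Unary.Any using (here; there)
  open import Data.Nat.Base
  open import Data.Nat.Divisibility using (_∣_; ∣-trans; ∣1⇒≡1)
  open import Data.Nat.ListAction.Properties using (∈⇒∣product)
  open import Data.Nat.Primality using (Prime; prime⇒nonTrivial)
  open import Data.Nat.Primality.Factorisation using (factorise; factorisationHasAllPrimeFactors)
  open import Data.Nat.Properties using (≤-refl; ≤-trans; ≮⇒≥; _<?_)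
  open import Data.Product using (_×_; _,_; ∃-syntax)
  open import Data.Sum using (_⊎_; inj₁; inj₂)
  open import Function using (id)
  open import Relation.Nullary using (yes; no; contradiction)
  open import Relation.Binary.PropositionalEquality using (refl; sym; subst)

  Smooth : ℕ → ℕ → Set
  Smooth p n = ∀ {s} → Prime s → s ∣ n → s ≤ p

  smooth-∣ : ∀ {p m n} → Smooth p n → m ∣ n → Smooth p m
  smooth-∣ smooth m∣n s-prime s∣m = smooth s-prime (∣-trans s∣m m∣n)

  largestPrimeFactor : ∀ n → .{{NonTrivial n}} → ∃[ p ] Prime p × p ∣ n × Smooth p n
  largestPrimeFactor n with factorise n ⦃ nonTrivial⇒nonZero n ⦄
  ... | record { factors = [] ; isFactorisation = n≡1 } = contradiction n≡1 nonTrivial⇒≢1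
  ... | record { factors = s ∷ ss ; isFactorisation = n≡Π ; factorsPrime = primes } =
    max s ss , All.lookup primes max∈ , subst (max s ss ∣_) (sym n≡Π) (∈⇒∣product max∈) , smooth
    where
    max∈ : max s ss ∈ s ∷ ss
    max∈ = argmax-all id (here refl) (All.tabulate there)
    smooth : Smooth (max s ss) n
    smooth t-prime t∣n = All.lookup (v≤max⁺ s ss (inj₁ ≤-refl) ∷ xs≤max s ss)
      (factorisationHasAllPrimeFactors t-prime (subst (_ ∣_) n≡Π t∣n) primes)

  smooth⊎largestPrimeFactor> : ∀ p n → .{{NonZero n}} →
                               Smooth p n ⊎ ∃[ s ] Prime s × s ∣ n × Smooth s n × p < s
  smooth⊎largestPrimeFactor> p 1 =
    inj₁ (λ s-prime s∣1 → contradiction (∣1⇒≡1 s∣1) (nonTrivial⇒≢1 ⦃ prime⇒nonTrivial s-prime ⦄))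
  smooth⊎largestPrimeFactor> p n@(2+ _) with largestPrimeFactor n
  ... | s , s-prime , s∣n , smooth with p <? s
  ...   | yes p<s = inj₂ (s , s-prime , s∣n , smooth , p<s)
  ...   | no  p≮s = inj₁ (λ t-prime t∣n → ≤-trans (smooth t-prime t∣n) (≮⇒≥ p≮s))


module TotientRatio where

  open import Data.List.Base using (_∷_; [])
  open import Data.List.Membership.Propositional using (_∈_)
  open import Data.List.Relation.Unary.All as All using (All; _∷_; [])
  open import Data.Nat.Base
  open import Data.Nat.Divisibility
  open import Data.Nat.Induction using (<-wellFounded)
  open import Data.Nat.ListAction using (product)
  open import Data.Nat.ListAction.Properties using (∈⇒∣product)
  open import Data.Nat.Primality using (Prime; prime⇒nonTrivial; prime⇒nonZero; euclidsLemma)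
  open import Data.Nat.Primality.Factorisation using (factorise)
  open import Data.Nat.Properties
  open import Data.Nat.Tactic.RingSolver using (solve-∀)
  open import Data.Product using (_,_)
  open import Data.Sum using (inj₁; inj₂)
  open import Induction.WellFounded using (Acc; acc)
  open import Relation.Nullary using (yes; no; ¬_)
  open import Relation.Nullary.Decidable using (decidable-stable)
  open import Relation.Binary.PropositionalEquality
  open Totient
  open SmoothNumbers
  open ≡-Reasoning

  prime∤* : ∀ {p m n} → Prime p → ¬ p ∣ m → ¬ p ∣ n → ¬ p ∣ m * n
  prime∤* {m = m} {n} pp p∤m p∤n p∣mn with euclidsLemma m n pp p∣mn
  ... | inj₁ p∣m = p∤m p∣m
  ... | inj₂ p∣n = p∤n p∣n

  prime∤pred : ∀ {p s} → Prime s → s ≤ p → ¬ p ∣ s ∸ 1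
  prime∤pred {s = suc s′} s-prime s≤p =
    >⇒∤ ⦃ >-nonZero (m<n⇒0<n∸m (nonTrivial⇒n>1 (suc s′) ⦃ prime⇒nonTrivial s-prime ⦄)) ⦄ s≤p

  prime∤totient-product : ∀ {p ps} → Prime p → All Prime ps → All (_< p) ps → ¬ p ∣ totient (product ps)
  prime∤totient-product pp [] [] p∣1 = nonTrivial⇒≢1 ⦃ prime⇒nonTrivial pp ⦄ (∣1⇒≡1 p∣1)
  prime∤totient-product {p} {s ∷ ss} pp (s-prime ∷ ss-prime) (s<p ∷ ss<p) with s ∣? product ss
  ... | yes s∣Π rewrite totient-*-∣ s (product ss) s∣Π =
    prime∤* pp (>⇒∤ ⦃ prime⇒nonZero s-prime ⦄ s<p) (prime∤totient-product pp ss-prime ss<p)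
  ... | no s∤Π rewrite totient-*-prime (product ss) s-prime s∤Π =
    prime∤* pp (prime∤pred s-prime (<⇒≤ s<p)) (prime∤totient-product pp ss-prime ss<p)

  prime∤totient : ∀ {p m} .{{_ : NonZero m}} → Prime p → Smooth p m → ¬ p ∣ m → ¬ p ∣ totient m
  prime∤totient {p} {m} pp smooth p∤m with factorise m
  ... | record { factors = ps ; isFactorisation = m≡Π ; factorsPrime = primes } =
    subst (λ n → ¬ p ∣ totient n) (sym m≡Π) (prime∤totient-product pp primes (All.tabulate below))
    where
    below : ∀ {s} → s ∈ ps → s < p
    below {s} s∈ps = ≤∧≢⇒< (smooth (All.lookup primes s∈ps) s∣m) (λ { refl → p∤m s∣m })
      where
      s∣m : s ∣ m
      s∣m = subst (s ∣_) (sym m≡Π) (∈⇒∣product s∈ps)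

  -- The p-adic valuation of φ(d) is one less than that of d.
  smooth∧∣⇒∤totient* : ∀ {p d x} .{{_ : NonZero d}} → Prime p → Smooth p d → p ∣ d → ¬ p ∣ x →
                       ¬ d ∣ totient d * x
  smooth∧∣⇒∤totient* {p} pp = go (<-wellFounded _)
    where
    instance _ = prime⇒nonZero pp
    go : ∀ {d x} → Acc _<_ d → .{{NonZero d}} → Smooth p d → p ∣ d → ¬ p ∣ x → ¬ d ∣ totient d * x
    go {x = x} (acc rec) smooth (divides q refl) p∤x qp∣ with p ∣? q
    ... | yes p∣q = go (rec q<qp) ⦃ q≢0 ⦄ (smooth-∣ smooth (m∣m*n p)) p∣q p∤x
                       (*-cancelʳ-∣ p (subst (q * p ∣_) totient[qp]*x≡ qp∣))
      where
      q≢0 = m*n≢0⇒m≢0 q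
      q<qp : q < q * p
      q<qp = m<m*n q p ⦃ q≢0 ⦄ (nonTrivial⇒n>1 p ⦃ prime⇒nonTrivial pp ⦄)
      totient[qp]*x≡ : totient (q * p) * x ≡ totient q * x * p
      totient[qp]*x≡ = begin
        totient (q * p) * x     ≡⟨ cong (λ n → totient n * x) (*-comm q p) ⟩
        totient (p * q) * x     ≡⟨ cong (_* x) (totient-*-∣ p q p∣q) ⟩
        p * totient q * x       ≡⟨ *-assoc p (totient q) x ⟩
        p * (totient q * x)     ≡⟨ *-comm p (totient q * x) ⟩
        totient q * x * p       ∎
    ... | no p∤q = prime∤* pp (prime∤* pp (prime∤pred pp ≤-refl) p∤totient[q]) p∤x
                     (∣-trans (n∣m*n q) (subst (q * p ∣_) totient[qp]*x≡ qp∣))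
      where
      p∤totient[q] : ¬ p ∣ totient q
      p∤totient[q] = prime∤totient ⦃ m*n≢0⇒m≢0 q ⦄ pp (smooth-∣ smooth (m∣m*n p)) p∤q
      totient[qp]*x≡ : totient (q * p) * x ≡ (p ∸ 1) * totient q * x
      totient[qp]*x≡ = cong (_* x) (trans (cong totient (*-comm q p)) (totient-*-prime q pp p∤q))

  EqualTotientRatio : ℕ → ℕ → Set
  EqualTotientRatio d e = totient d * e ≡ totient e * d

  equalTotientRatio-cancel : ∀ {c p d e} .{{_ : NonZero c}} .{{_ : NonZero p}} →
                             totient (d * p) ≡ c * totient d → totient (e * p) ≡ c * totient e →
                             EqualTotientRatio (d * p) (e * p) → EqualTotientRatio d e
  equalTotientRatio-cancel {c} {p} {d} {e} totient[dp] totient[ep] eq =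
    *-cancelˡ-≡ _ _ (c * p) ⦃ m*n≢0 c p ⦄ (begin
      c * p * (totient d * e)   ≡⟨ rearrange c p (totient d) e ⟩
      c * totient d * (e * p)   ≡⟨ cong (_* (e * p)) totient[dp] ⟨
      totient (d * p) * (e * p) ≡⟨ eq ⟩
      totient (e * p) * (d * p) ≡⟨ cong (_* (d * p)) totient[ep] ⟩
      c * totient e * (d * p)   ≡⟨ rearrange c p (totient e) d ⟨
      c * p * (totient e * d)   ∎)
    where
    rearrange : ∀ c p a b → c * p * (a * b) ≡ c * a * (b * p)
    rearrange = solve-∀

  ∤⇒¬equalTotientRatio : ∀ {p d₀ d} .{{_ : NonZero d₀}} → Prime p → p ∣ d₀ → Smooth p d₀ →
                         ¬ p ∣ d → ¬ EqualTotientRatio d d₀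
  ∤⇒¬equalTotientRatio {p} {d = zero} pp p∣d₀ smooth₀ p∤0 eq = p∤0 (p ∣0)
  ∤⇒¬equalTotientRatio {p} {d₀} {d@(suc _)} pp p∣d₀ smooth₀ p∤d eq with smooth⊎largestPrimeFactor> p d
  ... | inj₁ _ = smooth∧∣⇒∤totient* pp smooth₀ p∣d₀ p∤d (subst (d₀ ∣_) eq (n∣m*n (totient d)))
  ... | inj₂ (s , s-prime , s∣d , smooth , p<s) =
    smooth∧∣⇒∤totient* s-prime smooth s∣d (λ s∣d₀ → <⇒≱ p<s (smooth₀ s-prime s∣d₀))
      (subst (d ∣_) (sym eq) (n∣m*n (totient d₀)))

  equalTotientRatio⇒∣ : ∀ {p d₀ d} .{{_ : NonZero d₀}} → Prime p → p ∣ d₀ → Smooth p d₀ →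
                        EqualTotientRatio d d₀ → p ∣ d
  equalTotientRatio⇒∣ {p} {d = d} pp p∣d₀ smooth₀ eq =
    decidable-stable (p ∣? d) (λ p∤d → ∤⇒¬equalTotientRatio pp p∣d₀ smooth₀ p∤d eq)

module HarmonicSums where

  open import Data.Bool.Base using (true; false; if_then_else_)
  import Data.Integer.Base as ℤ
  open import Data.Nat.Base as ℕ using (ℕ; zero; suc; NonZero)
  open import Data.Nat.Divisibility using (_∣_; _∣?_)
  import Data.Nat.Properties as ℕ
  open import Data.Nat.Primality using (Prime; prime⇒nonTrivial; prime⇒nonZero)
  open import Data.Nat.Tactic.RingSolver using (solve-∀)
  open import Data.Product using (_×_; _,_)
  open import Data.Rational.Base using (ℚ; 0ℚ; 1ℚ; _≤_; _+_; _/_; toℚᵘ)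
  open import Data.Rational.Properties
  import Data.Rational.Unnormalised.Base as ℚᵘ
  import Data.Rational.Unnormalised.Properties as ℚᵘ
  open import Function using (_∘_)
  open import Relation.Nullary using (Dec; yes; no; does; ¬_)
  open import Relation.Nullary.Decidable using (dec-false; _×-dec_; ¬?)
  open import Relation.Binary.PropositionalEquality
  open Totient
  open SmoothNumbers
  open TotientRatio
  open RangeSum +-0-commutativeMonoid public

  recip : ℕ → ℚ
  recip zero    = 0ℚ
  recip (suc k) = ℤ.+ 1 / suc k

  recip-nonNeg : ∀ k → 0ℚ ≤ recip k
  recip-nonNeg zero    = ≤-refl
  recip-nonNeg (suc k) = nonNegative⁻¹ _ ⦃ normalize-nonNeg 1 (suc k) ⦄

  recip+recip≤ : ∀ {m n} .{{_ : NonZero m}} → 2 ℕ.* m ℕ.≤ n → recip n + recip n ≤ recip m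
  recip+recip≤ {suc m} {suc n} 2m≤n =
    toℚᵘ-cancel-≤ (ℚᵘ.≤-respˡ-≃ (ℚᵘ.≃-sym lhs≃) (ℚᵘ.≤-respʳ-≃ rhs≃ core))
    where
    ¹⁄ₘ ¹⁄ₙ : ℚᵘ.ℚᵘ
    ¹⁄ₘ = ℚᵘ.mkℚᵘ (ℤ.+ 1) m
    ¹⁄ₙ = ℚᵘ.mkℚᵘ (ℤ.+ 1) n
    rhs≃ : ¹⁄ₘ ℚᵘ.≃ toℚᵘ (recip (suc m))
    rhs≃ = ℚᵘ.≃-sym (toℚᵘ-fromℚᵘ ¹⁄ₘ)
    lhs≃ : toℚᵘ (recip (suc n) + recip (suc n)) ℚᵘ.≃ ¹⁄ₙ ℚᵘ.+ ¹⁄ₙ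
    lhs≃ = ℚᵘ.≃-trans (toℚᵘ-homo-+ (recip (suc n)) (recip (suc n)))
                      (ℚᵘ.+-cong (toℚᵘ-fromℚᵘ ¹⁄ₙ) (toℚᵘ-fromℚᵘ ¹⁄ₙ))
    core : ¹⁄ₙ ℚᵘ.+ ¹⁄ₙ ℚᵘ.≤ ¹⁄ₘ
    core = ℚᵘ.*≤* (ℤ.+≤+ (begin
      (1 ℕ.* suc n ℕ.+ 1 ℕ.* suc n) ℕ.* suc m ≡⟨ cross (suc n) (suc m) ⟩
      suc n ℕ.* (2 ℕ.* suc m)                ≤⟨ ℕ.*-monoʳ-≤ (suc n) 2m≤n ⟩
      suc n ℕ.* suc n                        ≡⟨ ℕ.*-identityˡ (suc n ℕ.* suc n) ⟨
      1 ℕ.* (suc n ℕ.* suc n)                ∎))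
      where
      open ℕ.≤-Reasoning
      cross : ∀ a b → (1 ℕ.* a ℕ.+ 1 ℕ.* a) ℕ.* b ≡ a ℕ.* (2 ℕ.* b)
      cross = solve-∀

  p+p≤1+1⇒p≤1 : ∀ {p} → p + p ≤ 1ℚ + 1ℚ → p ≤ 1ℚ
  p+p≤1+1⇒p≤1 p+p≤2 = ≮⇒≥ (λ 1<p → <-irrefl refl (<-≤-trans (+-mono-< 1<p 1<p) p+p≤2))

  ∑-nonNeg : ∀ n {f} → (∀ k → 0ℚ ≤ f k) → 0ℚ ≤ ∑ n f
  ∑-nonNeg zero    f≥0 = ≤-refl
  ∑-nonNeg (suc n) f≥0 = +-mono-≤ (∑-nonNeg n f≥0) (f≥0 (suc n))

  ∑-mono-≤ : ∀ n {f g} → (∀ k → f (suc k) ≤ g (suc k)) → ∑ n f ≤ ∑ n g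
  ∑-mono-≤ zero    f≤g = ≤-refl
  ∑-mono-≤ (suc n) f≤g = +-mono-≤ (∑-mono-≤ n f≤g) (f≤g n)

  ∑-mono-≤-length : ∀ {m n f} → (∀ k → 0ℚ ≤ f k) → m ℕ.≤ n → ∑ m f ≤ ∑ n f
  ∑-mono-≤-length {m} {f = f} f≥0 m≤n with ℕ.m≤n⇒∃[o]m+o≡n m≤n
  ... | o , refl = begin
    ∑ m f                                ≡⟨ +-identityʳ (∑ m f) ⟨
    ∑ m f + 0ℚ                           ≤⟨ +-monoʳ-≤ (∑ m f) (∑-nonNeg o (f≥0 ∘ (m ℕ.+_))) ⟩
    ∑ m f + ∑ o (λ k → f (m ℕ.+ k))      ≡⟨ ∑-+ m o f ⟨
    ∑ (m ℕ.+ o) f                        ∎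
    where open ≤-Reasoning

  weight : ∀ {P : Pred ℕ 0ℓ} → Decidable P → ℕ → ℚ
  weight P? k = if does (P? k) then recip k else 0ℚ

  weight-nonNeg : ∀ {P : Pred ℕ 0ℓ} (P? : Decidable P) k → 0ℚ ≤ weight P? k
  weight-nonNeg P? k with does (P? k)
  ... | true  = recip-nonNeg k
  ... | false = ≤-refl

  weight-no : ∀ {P : Pred ℕ 0ℓ} (P? : Decidable P) {k} → ¬ P k → weight P? k ≡ 0ℚ
  weight-no P? {k} ¬Pk = cong (if_then recip k else 0ℚ) (dec-false (P? k) ¬Pk)

  weight[1]≤1 : ∀ {P : Pred ℕ 0ℓ} (P? : Decidable P) → weight P? 1 ≤ 1ℚ
  weight[1]≤1 P? with does (P? 1)
  ... | true  = ≤-refl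
  ... | false = nonNegative⁻¹ 1ℚ

  ConstantTotientRatio : Pred ℕ 0ℓ → Set
  ConstantTotientRatio P = ∀ {d e} → P d → P e → EqualTotientRatio d e

  module Halving {p} (p-prime : Prime p) {P : Pred ℕ 0ℓ} (P? : Decidable P) (P-constant : ConstantTotientRatio P) where

    instance _ = prime⇒nonZero p-prime

    1<p : 1 ℕ.< p
    1<p = ℕ.nonTrivial⇒n>1 p ⦃ prime⇒nonTrivial p-prime ⦄

    Divisible Indivisible : Pred ℕ 0ℓ
    Divisible   e = P (e ℕ.* p) × p ∣ e
    Indivisible e = P (e ℕ.* p) × ¬ p ∣ e

    divisible? : Decidable Divisible
    divisible? e = P? (e ℕ.* p) ×-dec p ∣? e

    indivisible? : Decidable Indivisible
    indivisible? e = P? (e ℕ.* p) ×-dec ¬? (p ∣? e)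

    divisible-constant : ConstantTotientRatio Divisible
    divisible-constant {d} {e} (Pd , p∣d) (Pe , p∣e) =
      equalTotientRatio-cancel {d = d} {e} (totient[*p] p∣d) (totient[*p] p∣e) (P-constant Pd Pe)
      where
      totient[*p] : ∀ {e} → p ∣ e → totient (e ℕ.* p) ≡ p ℕ.* totient e
      totient[*p] {e} p∣e = trans (cong totient (ℕ.*-comm e p)) (totient-*-∣ p e p∣e)

    indivisible-constant : ConstantTotientRatio Indivisible
    indivisible-constant {d} {e} (Pd , p∤d) (Pe , p∤e) =
      equalTotientRatio-cancel {d = d} {e} ⦃ ℕ.>-nonZero (ℕ.m<n⇒0<n∸m 1<p) ⦄
        (totient[*p] p∤d) (totient[*p] p∤e) (P-constant Pd Pe)
      where
      totient[*p] : ∀ {e} → ¬ p ∣ e → totient (e ℕ.* p) ≡ (p ℕ.∸ 1) ℕ.* totient e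
      totient[*p] {e} p∤e = trans (cong totient (ℕ.*-comm e p)) (totient-*-prime e p-prime p∤e)

    recip[e*p]+recip[e*p]≤ : ∀ e .{{_ : NonZero e}} → recip (e ℕ.* p) + recip (e ℕ.* p) ≤ recip e
    recip[e*p]+recip[e*p]≤ e = recip+recip≤ (subst (ℕ._≤ e ℕ.* p) (ℕ.*-comm e 2) (ℕ.*-monoʳ-≤ e 1<p))

    weight-doubled≤ : ∀ e .{{_ : NonZero e}} →
                      weight P? (e ℕ.* p) + weight P? (e ℕ.* p) ≤ weight divisible? e + weight indivisible? e
    weight-doubled≤ e with P? (e ℕ.* p) | p ∣? e
    ... | no  _ | _     = ≤-refl
    ... | yes _ | yes _ = subst (recip (e ℕ.* p) + recip (e ℕ.* p) ≤_) (sym (+-identityʳ (recip e)))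
                            (recip[e*p]+recip[e*p]≤ e)
    ... | yes _ | no  _ = subst (recip (e ℕ.* p) + recip (e ℕ.* p) ≤_) (sym (+-identityˡ (recip e)))
                            (recip[e*p]+recip[e*p]≤ e)

    ∑-weight-multiples≤1 : ∀ n →
                           (∀ {Q} (Q? : Decidable Q) → ConstantTotientRatio Q → ∑ n (weight Q?) ≤ 1ℚ) →
                           ∑ n (λ e → weight P? (e ℕ.* p)) ≤ 1ℚ
    ∑-weight-multiples≤1 n ∑≤1 = p+p≤1+1⇒p≤1 (begin
      ∑ n (λ e → weight P? (e ℕ.* p)) + ∑ n (λ e → weight P? (e ℕ.* p))
        ≡⟨ ∑-∙ n _ _ ⟨
      ∑ n (λ e → weight P? (e ℕ.* p) + weight P? (e ℕ.* p))
        ≤⟨ ∑-mono-≤ n (λ e → weight-doubled≤ (suc e)) ⟩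
      ∑ n (λ e → weight divisible? e + weight indivisible? e)
        ≡⟨ ∑-∙ n _ _ ⟩
      ∑ n (weight divisible?) + ∑ n (weight indivisible?)
        ≤⟨ +-mono-≤ (∑≤1 divisible? divisible-constant) (∑≤1 indivisible? indivisible-constant) ⟩
      1ℚ + 1ℚ
        ∎)
      where open ≤-Reasoning

  ∑-weight≤1-suc : ∀ n .{{_ : NonZero n}} {P : Pred ℕ 0ℓ} (P? : Decidable P) → ConstantTotientRatio P →
                   (∀ {Q} (Q? : Decidable Q) → ConstantTotientRatio Q → ∑ n (weight Q?) ≤ 1ℚ) →
                   ∑ (suc n) (weight P?) ≤ 1ℚ
  ∑-weight≤1-suc n {P} P? P-constant ∑≤1 = extend (P? (suc n))
    where
    open ≤-Reasoning
    extend : Dec (P (suc n)) → ∑ (suc n) (weight P?) ≤ 1ℚ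
    extend (no ¬P[1+n]) = begin
      ∑ n (weight P?) + weight P? (suc n) ≡⟨ cong (λ w → ∑ n (weight P?) + w) (weight-no P? ¬P[1+n]) ⟩
      ∑ n (weight P?) + 0ℚ                ≡⟨ +-identityʳ _ ⟩
      ∑ n (weight P?)                     ≤⟨ ∑≤1 P? P-constant ⟩
      1ℚ                                  ∎
    extend (yes P[1+n]) with largestPrimeFactor (suc n) ⦃ ℕ.n>1⇒nonTrivial (ℕ.s<s (ℕ.>-nonZero⁻¹ n)) ⦄
    ... | p , p-prime , p∣1+n , smooth = begin
      ∑ (suc n) (weight P?)           ≤⟨ ∑-mono-≤-length (weight-nonNeg P?) (ℕ.m<m*n n p 1<p) ⟩
      ∑ (n ℕ.* p) (weight P?)         ≡⟨ ∑-multiples p (weight P?) (λ _ p∤k → weight-no P? (p∤k ∘ p∣)) n ⟩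
      ∑ n (λ e → weight P? (e ℕ.* p)) ≤⟨ Halving.∑-weight-multiples≤1 p-prime P? P-constant n ∑≤1 ⟩
      1ℚ                              ∎
      where
      instance _ = prime⇒nonZero p-prime
      1<p : 1 ℕ.< p
      1<p = ℕ.nonTrivial⇒n>1 p ⦃ prime⇒nonTrivial p-prime ⦄
      p∣ : ∀ {d} → P d → p ∣ d
      p∣ Pd = equalTotientRatio⇒∣ p-prime p∣1+n smooth (P-constant Pd P[1+n])

  ∑-weight≤1 : ∀ n {P : Pred ℕ 0ℓ} (P? : Decidable P) → ConstantTotientRatio P → ∑ n (weight P?) ≤ 1ℚ
  ∑-weight≤1 zero            P? _ = nonNegative⁻¹ 1ℚ
  ∑-weight≤1 (suc zero)      P? _ = subst (_≤ 1ℚ) (sym (+-identityˡ (weight P? 1))) (weight[1]≤1 P?)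
  ∑-weight≤1 (suc n@(suc _)) P? P-constant = ∑-weight≤1-suc n P? P-constant (λ Q? → ∑-weight≤1 n Q?)


open import Data.Empty using (⊥)
open import Data.Rational using (ℚ; Positive; _≤_; _+_; 1ℚ; _≟_)
open import Data.Rational.Properties using (normalize-injective-≃)
open import Relation.Nullary using (no)
open import Relation.Binary.PropositionalEquality using (_≡_; refl; sym; cong; subst)
open HarmonicSums

HasTotientRatio : ℚ → Pred ℕ 0ℓ
HasTotientRatio q zero    = ⊥
HasTotientRatio q (suc k) = totientRatio (suc k) ≡ q

hasTotientRatio? : ∀ q → Decidable (HasTotientRatio q)
hasTotientRatio? q zero    = no λ ()
hasTotientRatio? q (suc k) = totientRatio (suc k) ≟ q

hasTotientRatio-constant : ∀ {q} → ConstantTotientRatio (HasTotientRatio q)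
hasTotientRatio-constant {d = suc a} {suc b} refl eq =
  normalize-injective-≃ (totient (suc a)) (totient (suc b)) (suc a) (suc b) (sym eq)

partialSum≡∑weight : ∀ q N → partialSum q N ≡ ∑ N (weight (hasTotientRatio? q))
partialSum≡∑weight q zero    = refl
partialSum≡∑weight q (suc N) = cong (_+ term q (suc N)) (partialSum≡∑weight q N)

proposition1p4 : (q : ℚ) → Positive q → (N : ℕ) → partialSum q N ≤ 1ℚ
proposition1p4 q _ N =
  subst (_≤ 1ℚ) (sym (partialSum≡∑weight q N)) (∑-weight≤1 N (hasTotientRatio? q) hasTotientRatio-constant)
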